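{- Let $T$ be a tree on $n$ vertices. Suppose $p,q$ are vertices of $T$ such that $p$ is a pendant vertex of $T$ and $q$ is the (quasi-pendant) vertex adjacent to $p$. Let $u$ be a neighbour of $q$ other than $p$, and let $B_u$ be the connected component of $T-q$ containing $u$. Then for every unordered pair $\{i,j\}$ of distinct vertices of $T$, $$\mathrm{Max4PC}_T(\{p,q\},\{i,j\}) = \begin{cases} \mathrm{Max4PC}_T(\{u,q\},\{i,j\})+2 & \text{if } i,j\in B_u,\\ \mathrm{Max4PC}_T(\{u,q\},\{i,j\}) & \text{otherwise.}\end{cases}$$
   Context: For a tree $T$ and vertices $x,y$, $d_{x,y}$ denotes the distance between $x$ and $y$ in $T$. $\mathrm{Max4PC}_T$ is the matrix with rows and columns indexed by unordered pairs of distinct vertices of $T$, whose entry $\mathrm{Max4PC}_T(\{w,x\},\{y,z\})$ in row $\{w,x\}$ and column $\{y,z\}$ is $\max\{d_{w,x}+d_{y,z},\ d_{w,y}+d_{x,z},\ d_{w,z}+d_{x,y}\}$. $T-q$ denotes the forest obtained by deleting vertex $q$. -}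

module Defs where

open import Data.Nat using (ℕ; zero; suc; _+_; _≤_; _⊔_)
open import Data.Fin using (Fin)
open import Data.List using (List; []; _∷_)
open import Data.List.Relation.Unary.All using (All)
open import Data.List.Relation.Unary.Unique.Propositional using (Unique)
open import Data.Product using (Σ; _×_; _,_)
open import Data.Empty using (⊥)
open import Relation.Nullary using (¬_)
open import Relation.Binary.PropositionalEquality using (_≡_; _≢_)

record Graph (n : ℕ) : Set₁ where
  field
    Adj     : Fin n → Fin n → Set
    sym     : ∀ {x y} → Adj x y → Adj y x
    irrefl  : ∀ {x} → ¬ Adj x x
open Graph public

data Walk {n : ℕ} (G : Graph n) : Fin n → Fin n → Set where
  nil  : ∀ {x} → Walk G x x
  cons : ∀ {x y z} → Adj G x y → Walk G y z → Walk G x z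

len : ∀ {n} {G : Graph n} {x y} → Walk G x y → ℕ
len nil        = zero
len (cons _ w) = suc (len w)

verts : ∀ {n} {G : Graph n} {x y} → Walk G x y → List (Fin n)
verts (nil {x})      = x ∷ []
verts (cons {x} _ w) = x ∷ verts w

Connected : ∀ {n} → Graph n → Set
Connected G = ∀ x y → Walk G x y

Cycle : ∀ {n} → Graph n → Set
Cycle G = Σ _ λ x → Σ _ λ y → Σ (Walk G x y) λ w →
  (2 ≤ len w) × Unique (verts w) × Adj G y x

Acyclic : ∀ {n} → Graph n → Set
Acyclic G = ¬ Cycle G

IsTree : ∀ {n} → Graph n → Set
IsTree G = Connected G × Acyclic G

IsDistance : ∀ {n} → Graph n → (Fin n → Fin n → ℕ) → Set
IsDistance G d = ∀ x y →
  (Σ (Walk G x y) λ w → len w ≡ d x y) × (∀ (w : Walk G x y) → d x y ≤ len w)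

PendantAt : ∀ {n} → Graph n → Fin n → Fin n → Set
PendantAt G p q = Adj G p q × (∀ v → Adj G p v → v ≡ q)

-- v lies in the connected component of G - q containing u
InComponentMinus : ∀ {n} → Graph n → (q u v : Fin n) → Set
InComponentMinus G q u v = Σ (Walk G u v) λ w → All (_≢ q) (verts w)

Max4PC : ∀ {n} → (Fin n → Fin n → ℕ) → (w x y z : Fin n) → ℕ
Max4PC d w x y z = (d w x + d y z) ⊔ (d w y + d x z) ⊔ (d w z + d x y)

-- Every shortest walk from p starts with the edge pq, so d(p,x) = d(q,x) + 1 for x ≠ p; for a
-- neighbour u of q, the walks from u that avoid q are those inside B_u, so d(u,x) = d(q,x) + 1
-- outside B_u while, by acyclicity, d(q,x) = d(u,x) + 1 inside B_u.  For adjacent w, x with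
-- d(w,y) = d(x,y) + 1 for y ∈ {i, j}, one of them, the triangle inequality through x shows that
-- Max4PC({w,x},{i,j}) = d(x,i) + d(x,j) + 1.  Applied to (p,q), to (u,q) outside B_u and to (q,u)
-- inside B_u, this gives both cases.
module Submission where

open import Defs
open import Data.Nat using (ℕ; _+_; suc; _≤_; _⊔_; s≤s; z≤n)
open import Data.Nat.Properties
  using (≤-refl; ≤-trans; ≤-reflexive; ≤-antisym; <-irrefl; m≤n⇒m≤1+n; +-comm; +-suc; +-mono-≤;
         ⊔-lub; ⊔-comm; ⊔-assoc; m≤m⊔n; m≤n⊔m)
open import Data.Fin using (Fin; _≟_)
open import Data.Product using (Σ; _×_; _,_; proj₁; proj₂)
open import Data.Sum using (_⊎_; inj₁; inj₂)
open import Data.Empty using (⊥-elim)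
open import Data.List using (_∷_; [])
open import Data.List.Relation.Unary.All using (All; _∷_; [])
import Data.List.Relation.Unary.All as All
open import Data.List.Relation.Unary.All.Properties using (¬Any⇒All¬; anti-mono)
open import Data.List.Relation.Unary.Any using (here; there)
open import Data.List.Relation.Unary.AllPairs using (_∷_; [])
open import Data.List.Relation.Unary.Unique.Propositional using (Unique)
open import Data.List.Membership.Propositional using (_∈_)
open import Data.List.Relation.Binary.Subset.Propositional using (_⊆_)
open import Data.List.Relation.Binary.Subset.Propositional.Properties using (∷⁺ʳ)
open import Function using (_∘_)
open import Relation.Nullary using (¬_; Dec; yes; no)
open import Relation.Binary.PropositionalEquality
  using (_≡_; _≢_; refl; cong; cong₂; trans; ≢-sym; module ≡-Reasoning)
  renaming (sym to ≡-sym)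

module Walks {n : ℕ} (G : Graph n) where
  open import Data.List.Membership.DecPropositional (_≟_ {n}) using (_∈?_)

  infixr 5 _++ʷ_

  _++ʷ_ : ∀ {a b c} → Walk G a b → Walk G b c → Walk G a c
  nil      ++ʷ w₂ = w₂
  cons e w ++ʷ w₂ = cons e (w ++ʷ w₂)

  len-++ʷ : ∀ {a b c} (w₁ : Walk G a b) (w₂ : Walk G b c) → len (w₁ ++ʷ w₂) ≡ len w₁ + len w₂
  len-++ʷ nil        w₂ = refl
  len-++ʷ (cons e w) w₂ = cong suc (len-++ʷ w w₂)

  All-++ʷ : ∀ {P : Fin n → Set} {a b c} (w₁ : Walk G a b) (w₂ : Walk G b c) →
            All P (verts w₁) → All P (verts w₂) → All P (verts (w₁ ++ʷ w₂))
  All-++ʷ nil        w₂ _          pw₂ = pw₂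
  All-++ʷ (cons e w) w₂ (pa ∷ pw₁) pw₂ = pa ∷ All-++ʷ w w₂ pw₁ pw₂

  All-head : ∀ {P : Fin n → Set} {a b} (w : Walk G a b) → All P (verts w) → P a
  All-head nil        (pa ∷ _) = pa
  All-head (cons e w) (pa ∷ _) = pa

  All-last : ∀ {P : Fin n → Set} {a b} (w : Walk G a b) → All P (verts w) → P b
  All-last nil        (pb ∷ _) = pb
  All-last (cons e w) (_ ∷ pw) = All-last w pw

  reverse : ∀ {a b} → Walk G a b → Walk G b a
  reverse nil        = nil
  reverse (cons e w) = reverse w ++ʷ cons (sym G e) nil

  len-reverse : ∀ {a b} (w : Walk G a b) → len (reverse w) ≡ len w
  len-reverse nil        = refl
  len-reverse (cons e w) = begin
    len (reverse w ++ʷ cons (sym G e) nil) ≡⟨ len-++ʷ (reverse w) _ ⟩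
    len (reverse w) + 1                    ≡⟨ +-comm (len (reverse w)) 1 ⟩
    suc (len (reverse w))                  ≡⟨ cong suc (len-reverse w) ⟩
    suc (len w)                            ∎
    where open ≡-Reasoning

  All-reverse : ∀ {P : Fin n → Set} {a b} (w : Walk G a b) →
                All P (verts w) → All P (verts (reverse w))
  All-reverse nil        pw        = pw
  All-reverse (cons e w) (pa ∷ pw) =
    All-++ʷ (reverse w) _ (All-reverse w pw) (All-head w pw ∷ pa ∷ [])

  suffix : ∀ {a b x} (w : Walk G a b) → x ∈ verts w → Walk G x b
  suffix nil        (here refl) = nil
  suffix (cons e w) (here refl) = cons e w
  suffix (cons e w) (there x∈w) = suffix w x∈w

  len-suffix : ∀ {a b x} (w : Walk G a b) (x∈w : x ∈ verts w) → len (suffix w x∈w) ≤ len w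
  len-suffix nil        (here refl) = ≤-refl
  len-suffix (cons e w) (here refl) = ≤-refl
  len-suffix (cons e w) (there x∈w) = m≤n⇒m≤1+n (len-suffix w x∈w)

  suffix-⊆ : ∀ {a b x} (w : Walk G a b) (x∈w : x ∈ verts w) → verts (suffix w x∈w) ⊆ verts w
  suffix-⊆ nil        (here refl) = λ y∈w → y∈w
  suffix-⊆ (cons e w) (here refl) = λ y∈w → y∈w
  suffix-⊆ (cons e w) (there x∈w) = there ∘ suffix-⊆ w x∈w

  Unique-suffix : ∀ {a b x} (w : Walk G a b) (x∈w : x ∈ verts w) →
                  Unique (verts w) → Unique (verts (suffix w x∈w))
  Unique-suffix nil        (here refl) u       = u
  Unique-suffix (cons e w) (here refl) u       = u
  Unique-suffix (cons e w) (there x∈w) (_ ∷ u) = Unique-suffix w x∈w u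

  toPath : ∀ {a b} (w : Walk G a b) →
           Σ (Walk G a b) λ path → Unique (verts path) × verts path ⊆ verts w
  toPath nil = nil , [] ∷ [] , λ y∈w → y∈w
  toPath (cons {a} e w) with toPath w
  ... | path , unique , path⊆w with a ∈? verts path
  ...   | yes a∈path = suffix path a∈path , Unique-suffix path a∈path unique ,
                       λ y∈ → there (path⊆w (suffix-⊆ path a∈path y∈))
  ...   | no  a∉path = cons e path , ¬Any⇒All¬ (verts path) a∉path ∷ unique , ∷⁺ʳ a path⊆w

  1≤len : ∀ {a b} (w : Walk G a b) → a ≢ b → 1 ≤ len w
  1≤len nil        a≢b = ⊥-elim (a≢b refl)
  1≤len (cons e w) a≢b = s≤s z≤n

  cycle-through : ∀ {q u v} → Adj G q u → Adj G v q → u ≢ v →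
                  (w : Walk G u v) → All (_≢ q) (verts w) → Cycle G
  cycle-through {q} {u} {v} q~u v~q u≢v w w-avoids-q with toPath w
  ... | path , unique , path⊆w =
    q , v , cons q~u path , s≤s (1≤len path u≢v) ,
    All.map ≢-sym (anti-mono path⊆w w-avoids-q) ∷ unique , v~q

module Distance {n : ℕ} {G : Graph n} {d : Fin n → Fin n → ℕ} (isD : IsDistance G d) where
  open Walks G
  open import Data.List.Membership.DecPropositional (_≟_ {n}) using (_∈?_)

  shortest : ∀ x y → Walk G x y
  shortest x y = proj₁ (proj₁ (isD x y))

  len-shortest : ∀ x y → len (shortest x y) ≡ d x y
  len-shortest x y = proj₂ (proj₁ (isD x y))

  d≤len : ∀ {x y} (w : Walk G x y) → d x y ≤ len w
  d≤len {x} {y} = proj₂ (isD x y)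

  d≤len-suffix : ∀ {a b x} (w : Walk G a b) → x ∈ verts w → d x b ≤ len w
  d≤len-suffix w x∈w = ≤-trans (d≤len (suffix w x∈w)) (len-suffix w x∈w)

  d-sym : ∀ x y → d x y ≡ d y x
  d-sym x y = ≤-antisym (d≤d-flipped x y) (d≤d-flipped y x)
    where
    d≤d-flipped : ∀ x y → d x y ≤ d y x
    d≤d-flipped x y = ≤-trans (d≤len (reverse (shortest y x)))
                              (≤-reflexive (trans (len-reverse _) (len-shortest y x)))

  d-triangle : ∀ x y z → d x z ≤ d x y + d y z
  d-triangle x y z = ≤-trans (d≤len (shortest x y ++ʷ shortest y z))
    (≤-reflexive (trans (len-++ʷ (shortest x y) (shortest y z))
                        (cong₂ _+_ (len-shortest x y) (len-shortest y z))))

  d-adj : ∀ {x y} z → Adj G x y → d x z ≤ suc (d y z)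
  d-adj {y = y} z x~y = ≤-trans (d≤len (cons x~y (shortest y z))) (s≤s (≤-reflexive (len-shortest y z)))

  d-pendant : ∀ {p q} → PendantAt G p q → ∀ x → x ≢ p → d p x ≡ suc (d q x)
  d-pendant {p} {q} (p~q , only-q) x x≢p =
    ≤-antisym (d-adj x p~q) (≤-trans (via-q (shortest p x) x≢p) (≤-reflexive (len-shortest p x)))
    where
    via-q : (w : Walk G p x) → x ≢ p → suc (d q x) ≤ len w
    via-q nil              x≢p = ⊥-elim (x≢p refl)
    via-q (cons {y = v} e w) _ with only-q v e
    ... | refl = s≤s (d≤len w)

  module Branch {q u : Fin n} (q~u : Adj G q u) where

    u≢q : u ≢ q
    u≢q refl = irrefl G q~u

    Bᵤ : Fin n → Set
    Bᵤ = InComponentMinus G q u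

    outside-Bᵤ : ∀ x → Bᵤ x ⊎ d u x ≡ suc (d q x)
    outside-Bᵤ x with q ∈? verts (shortest u x)
    ... | no  q∉w = inj₁ (shortest u x , All.map ≢-sym (¬Any⇒All¬ _ q∉w))
    ... | yes q∈w = inj₂ (≤-antisym (d-adj x (sym G q~u))
                                     (≤-trans (via-q (shortest u x) q∈w) (≤-reflexive (len-shortest u x))))
      where
      via-q : ∀ {x} (w : Walk G u x) → q ∈ verts w → suc (d q x) ≤ len w
      via-q nil        (here q≡u)  = ⊥-elim (u≢q (≡-sym q≡u))
      via-q (cons e w) (here q≡u)  = ⊥-elim (u≢q (≡-sym q≡u))
      via-q (cons e w) (there q∈w) = s≤s (d≤len-suffix w q∈w)

    -- A shortest q–x walk leaving q through a neighbour v ≠ u would close a cycle with the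
    -- q-avoiding u–x walk.
    inside-Bᵤ : Acyclic G → ∀ {x} → Bᵤ x → d q x ≡ suc (d u x)
    inside-Bᵤ acyclic {x} (w , w-avoids-q) =
      ≤-antisym (d-adj x q~u) (≤-trans (via-u (shortest q x) (len-shortest q x))
                                       (≤-reflexive (len-shortest q x)))
      where
      via-u : (s : Walk G q x) → len s ≡ d q x → suc (d u x) ≤ len s
      via-u nil _ = ⊥-elim (All-last w w-avoids-q refl)
      via-u (cons {y = v} q~v s) s-shortest with v ≟ u | q ∈? verts s
      ... | yes refl | _       = s≤s (d≤len s)
      ... | no  _    | yes q∈s =
        ⊥-elim (<-irrefl refl (≤-trans (s≤s (d≤len-suffix s q∈s)) (≤-reflexive s-shortest)))
      ... | no  v≢u  | no  q∉s = ⊥-elim (acyclic (cycle-through q~u (sym G q~v) (≢-sym v≢u)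
        (w ++ʷ reverse s)
        (All-++ʷ w (reverse s) w-avoids-q (All-reverse s (All.map ≢-sym (¬Any⇒All¬ _ q∉s))))))

⊔₃-attained : ∀ {x y z m} → x ≤ m → y ≤ m → z ≤ m → y ≡ m ⊎ z ≡ m → x ⊔ y ⊔ z ≡ m
⊔₃-attained {x} {y} {z} {m} x≤m y≤m z≤m attained = ≤-antisym (⊔-lub (⊔-lub x≤m y≤m) z≤m) (m≤ attained)
  where
  m≤ : y ≡ m ⊎ z ≡ m → m ≤ x ⊔ y ⊔ z
  m≤ (inj₁ refl) = ≤-trans (m≤n⊔m x y) (m≤m⊔n (x ⊔ y) z)
  m≤ (inj₂ refl) = m≤n⊔m (x ⊔ y) z

module Max4PCProperties {n : ℕ} {G : Graph n} {d : Fin n → Fin n → ℕ} (isD : IsDistance G d) where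
  open Distance isD

  Max4PC-swap : ∀ w x i j → Max4PC d w x i j ≡ Max4PC d x w i j
  Max4PC-swap w x i j = begin
    (d w x + d i j) ⊔ (d w i + d x j) ⊔ (d w j + d x i)   ≡⟨ cong (λ a → (a + d i j) ⊔ (d w i + d x j) ⊔ (d w j + d x i)) (d-sym w x) ⟩
    (d x w + d i j) ⊔ (d w i + d x j) ⊔ (d w j + d x i)   ≡⟨ cong₂ (λ b c → (d x w + d i j) ⊔ b ⊔ c)
                                                               (+-comm (d w i) (d x j)) (+-comm (d w j) (d x i)) ⟩
    (d x w + d i j) ⊔ (d x j + d w i) ⊔ (d x i + d w j)   ≡⟨ ⊔-assoc (d x w + d i j) _ _ ⟩
    (d x w + d i j) ⊔ ((d x j + d w i) ⊔ (d x i + d w j)) ≡⟨ cong (d x w + d i j ⊔_) (⊔-comm (d x j + d w i) (d x i + d w j)) ⟩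
    (d x w + d i j) ⊔ ((d x i + d w j) ⊔ (d x j + d w i)) ≡⟨ ⊔-assoc (d x w + d i j) _ _ ⟨
    (d x w + d i j) ⊔ (d x i + d w j) ⊔ (d x j + d w i)   ∎
    where open ≡-Reasoning

  Max4PC-adjacent : ∀ {w x} i j → Adj G w x → d w i ≡ suc (d x i) ⊎ d w j ≡ suc (d x j) →
                    Max4PC d w x i j ≡ suc (d x i + d x j)
  Max4PC-adjacent {w} {x} i j w~x farther = ⊔₃-attained
    (+-mono-≤ (d≤len (cons w~x nil))
              (≤-trans (d-triangle i x j) (≤-reflexive (cong (_+ d x j) (d-sym i x)))))
    (+-mono-≤ (d-adj i w~x) ≤-refl)
    (≤-trans (+-mono-≤ (d-adj j w~x) ≤-refl) (≤-reflexive swap))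
    (attained farther)
    where
    swap : suc (d x j) + d x i ≡ suc (d x i + d x j)
    swap = cong suc (+-comm (d x j) (d x i))
    attained : d w i ≡ suc (d x i) ⊎ d w j ≡ suc (d x j) →
               d w i + d x j ≡ suc (d x i + d x j) ⊎ d w j + d x i ≡ suc (d x i + d x j)
    attained (inj₁ e) = inj₁ (cong (_+ d x j) e)
    attained (inj₂ e) = inj₂ (trans (cong (_+ d x i) e) swap)

lemma2p2 : (n : ℕ) (T : Graph n) → IsTree T →
    (d : Fin n → Fin n → ℕ) → IsDistance T d →
    (p q u : Fin n) → PendantAt T p q → Adj T q u → u ≢ p →
    (i j : Fin n) → i ≢ j →
      ((InComponentMinus T q u i × InComponentMinus T q u j) →
         Max4PC d p q i j ≡ Max4PC d u q i j + 2)
      × (¬ (InComponentMinus T q u i × InComponentMinus T q u j) →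
         Max4PC d p q i j ≡ Max4PC d u q i j)
lemma2p2 n T (_ , acyclic) d isD p q u pendant q~u _ i j i≢j = inside , outside
  where
  open Distance isD
  open Branch q~u
  open Max4PCProperties isD
  open ≡-Reasoning

  pq-side : Max4PC d p q i j ≡ suc (d q i + d q j)
  pq-side = Max4PC-adjacent i j (proj₁ pendant) (pendant-farther (i ≟ p))
    where
    pendant-farther : Dec (i ≡ p) → d p i ≡ suc (d q i) ⊎ d p j ≡ suc (d q j)
    pendant-farther (yes refl) = inj₂ (d-pendant pendant j (≢-sym i≢j))
    pendant-farther (no  i≢p)  = inj₁ (d-pendant pendant i i≢p)

  inside : Bᵤ i × Bᵤ j → Max4PC d p q i j ≡ Max4PC d u q i j + 2
  inside (i∈B , j∈B) = begin
    Max4PC d p q i j                 ≡⟨ pq-side ⟩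
    suc (d q i + d q j)              ≡⟨ cong suc (cong₂ _+_ (inside-Bᵤ acyclic i∈B) (inside-Bᵤ acyclic j∈B)) ⟩
    suc (suc (d u i) + suc (d u j))  ≡⟨ trans (cong suc (+-suc (suc (d u i)) (d u j))) (+-comm 2 _) ⟩
    suc (d u i + d u j) + 2          ≡⟨ cong (_+ 2) (Max4PC-adjacent i j q~u (inj₁ (inside-Bᵤ acyclic i∈B))) ⟨
    Max4PC d q u i j + 2             ≡⟨ cong (_+ 2) (Max4PC-swap q u i j) ⟩
    Max4PC d u q i j + 2             ∎

  outside : ¬ (Bᵤ i × Bᵤ j) → Max4PC d p q i j ≡ Max4PC d u q i j
  outside not-both = trans pq-side
    (≡-sym (Max4PC-adjacent i j (sym T q~u) (farther (outside-Bᵤ i) (outside-Bᵤ j))))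
    where
    farther : Bᵤ i ⊎ d u i ≡ suc (d q i) → Bᵤ j ⊎ d u j ≡ suc (d q j) → d u i ≡ suc (d q i) ⊎ d u j ≡ suc (d q j)
    farther (inj₂ e)   _          = inj₁ e
    farther (inj₁ _)   (inj₂ e)   = inj₂ e
    farther (inj₁ i∈B) (inj₁ j∈B) = ⊥-elim (not-both (i∈B , j∈B))
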